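{- Let $k$ be a field of characteristic $0$ and $n$ a positive integer. Let $V$ be a vector space with basis $\{v_{i,j}\}_{i\ge1,\,1\le j\le n}$, let $V_m$ be the span of the $v_{i,j}$ with $1\le i\le m$, $1\le j\le n$, let $x_{i,j}\in V^*$ be the dual vectors, and let $\omega=\sum_{i=1}^\infty x_{i,1}\otimes\cdots\otimes x_{i,n}$ (an $n$-form on $V$). Then $(V,\omega)$ is a universal $n$-space. Moreover, for every $d$ there exists $m$ such that $V_m$ with the restriction of $\omega$ is a $d$-universal $n$-space.
   Context: An $n$-form on $V$ is a multilinear map $V^n\to k$ (the infinite sum defining $\omega$ has only finitely many non-zero terms on any input); an $n$-space is a vector space with an $n$-form. An embedding of $n$-spaces is an injective linear map along which the form pulls back to the given form. An $n$-space is universal if every finite-dimensional $n$-space embeds into it, and $d$-universal if every $d$-dimensional $n$-space embeds into it. -}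

module Defs where

open import Level using (Level; _⊔_; suc)
open import Data.Nat as ℕ using (ℕ; zero; suc; _≥_)
open import Data.Fin using (Fin)
open import Data.Product using (Σ; Σ-syntax; ∃; ∃-syntax; _×_; _,_; proj₁; proj₂)
open import Data.Vec.Functional using (Vector; updateAt; foldr)
open import Function using (const)
open import Relation.Nullary using (¬_)
open import Relation.Binary.PropositionalEquality using (_≡_)
open import Algebra.Bundles using (CommutativeRing)

record Field (c ℓ : Level) : Set (Level.suc (c ⊔ ℓ)) where
  field
    commutativeRing : CommutativeRing c ℓ
  open CommutativeRing commutativeRing public
  field
    0≉1     : ¬ (0# ≈ 1#)
    inverse : ∀ x → ¬ (x ≈ 0#) → ∃[ y ] (x * y ≈ 1#)

module _ {c ℓ} (F : Field c ℓ) where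
  open Field F

  natCast : ℕ → Carrier
  natCast zero    = 0#
  natCast (suc m) = 1# + natCast m

  CharZero : Set ℓ
  CharZero = ∀ m → natCast m ≈ 0# → m ≡ 0

  ∑ : ∀ {m} → Vector Carrier m → Carrier
  ∑ = foldr _+_ 0#

  ∏ : ∀ {m} → Vector Carrier m → Carrier
  ∏ = foldr _*_ 1#

  record NSpace (n : ℕ) (a r : Level) : Set (c ⊔ ℓ ⊔ Level.suc (a ⊔ r)) where
    field
      V     : Set a
      _≈V_  : V → V → Set r
      _+V_  : V → V → V
      _·V_  : Carrier → V → V
      form  : Vector V n → Carrier

  module _ {n : ℕ} {a r b s : Level} (S : NSpace n a r) (T : NSpace n b s) where
    private
      module S = NSpace S
      module T = NSpace T

    record Embedding : Set (c ⊔ ℓ ⊔ a ⊔ r ⊔ b ⊔ s) where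
      field
        f         : S.V → T.V
        cong      : ∀ {u v} → u S.≈V v → f u T.≈V f v
        additive  : ∀ u v → f (u S.+V v) T.≈V (f u T.+V f v)
        homog     : ∀ λ' u → f (λ' S.·V u) T.≈V (λ' T.·V f u)
        injective : ∀ {u v} → f u T.≈V f v → u S.≈V v
        pullback  : ∀ (us : Vector S.V n) → T.form (λ j → f (us j)) ≈ S.form us

  -- The standard d-dimensional space k^d (every d-dimensional vector
  -- space is isomorphic to it).

  Kd : ℕ → Set c
  Kd d = Fin d → Carrier

  _≈d_ : ∀ {d} → Kd d → Kd d → Set ℓ
  u ≈d v = ∀ i → u i ≈ v i

  record Multilinear (n d : ℕ) (φ : Vector (Kd d) n → Carrier) : Set (c ⊔ ℓ) where
    field
      φ-cong  : ∀ {us vs : Vector (Kd d) n} → (∀ j → us j ≈d vs j) → φ us ≈ φ vs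
      φ-add   : ∀ (us : Vector (Kd d) n) j (u v : Kd d) →
                φ (updateAt us j (const (λ i → u i + v i)))
                  ≈ φ (updateAt us j (const u)) + φ (updateAt us j (const v))
      φ-scale : ∀ (us : Vector (Kd d) n) j (λ' : Carrier) (u : Kd d) →
                φ (updateAt us j (const (λ i → λ' * u i)))
                  ≈ λ' * φ (updateAt us j (const u))

  KdSpace : (n d : ℕ) → (Vector (Kd d) n → Carrier) → NSpace n c ℓ
  KdSpace n d φ = record
    { V = Kd d ; _≈V_ = λ u v → u ≈d v
    ; _+V_ = λ u v i → u i + v i ; _·V_ = λ λ' u i → λ' * u i ; form = φ }

  DUniversal : ∀ {n a r} → ℕ → NSpace n a r → Set (c ⊔ ℓ ⊔ a ⊔ r)
  DUniversal {n} d T =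
    (φ : Vector (Kd d) n → Carrier) → Multilinear n d φ → Embedding (KdSpace n d φ) T

  Universal : ∀ {n a r} → NSpace n a r → Set (c ⊔ ℓ ⊔ a ⊔ r)
  Universal T = ∀ d → DUniversal d T

  -- The space V with basis v_{i,j} (i ≥ 1, 1 ≤ j ≤ n), indexed here by
  -- i ∈ ℕ (i.e. i-1) and j ∈ Fin n: finitely supported coefficient
  -- families.

  record Vinf (n : ℕ) : Set (c ⊔ ℓ) where
    field
      coeff   : ℕ → Fin n → Carrier
      bound   : ℕ
      support : ∀ i → i ≥ bound → ∀ j → coeff i j ≈ 0#
  open Vinf public

  -- ω = Σ_i x_{i,1} ⊗ … ⊗ x_{i,n}; the sum is truncated at an index
  -- beyond the supports of all arguments (later terms vanish).
  ω : ∀ {n} → Vector (Vinf n) n → Carrier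
  ω {n} us = ∑ {N} (λ i → ∏ (λ j → coeff (us j) (Data.Fin.toℕ i) j))
    where N = foldr ℕ._⊔_ 0 (λ j → bound (us j))

  Vspace : (n : ℕ) → NSpace n (c ⊔ ℓ) ℓ
  Vspace n = record
    { V = Vinf n
    ; _≈V_ = λ u v → ∀ i j → coeff u i j ≈ coeff v i j
    ; _+V_ = λ u v → record
        { coeff = λ i j → coeff u i j + coeff v i j
        ; bound = bound u ℕ.⊔ bound v
        ; support = λ i i≥ j → trans (+-cong (support u i (ℕ-p.m⊔n≤o⇒m≤o _ _ i≥) j)
                                              (support v i (ℕ-p.m⊔n≤o⇒n≤o _ _ i≥) j))
                                      (+-identityˡ 0#) }
    ; _·V_ = λ λ' u → record
        { coeff = λ i j → λ' * coeff u i j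
        ; bound = bound u
        ; support = λ i i≥ j → trans (*-congˡ (support u i i≥ j)) (zeroʳ λ') }
    ; form = ω }
    where import Data.Nat.Properties as ℕ-p

  Vm : (n m : ℕ) → NSpace n c ℓ
  Vm n m = record
    { V = Fin m → Fin n → Carrier
    ; _≈V_ = λ u v → ∀ i j → u i j ≈ v i j
    ; _+V_ = λ u v i j → u i j + v i j
    ; _·V_ = λ λ' u i j → λ' * u i j
    ; form = λ us → ∑ (λ i → ∏ (λ j → us j i j)) }

{-# OPTIONS --safe #-}
module Submission where

-- Expanding all but the last argument of a multilinear form φ of arity n on k^d
-- in the standard basis writes φ as the sum, over k₁ … k_(n-1), of the pure tensors
-- x_k₁ ⊗ ⋯ ⊗ x_k_(n-1) ⊗ φ(e_k₁, …, e_k_(n-1), -) of linear forms. Adding the pairs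
-- x_k ⊗ ⋯ ⊗ x_k and (−x_k) ⊗ x_k ⊗ ⋯ ⊗ x_k changes nothing but makes the factors
-- separate points. Then u ↦ (l_{i,j}(u))_{i,j} embeds (k^d, φ) into V_m with
-- m = 2d + d^(n-1), and V_m lies inside V.

open import Defs
open import Level using (Level; _⊔_)
open import Data.Nat as ℕ using (ℕ; zero; suc; _≤_; _^_; z≤n; s≤s)
open import Data.Nat.Properties using (m≤m⊔n)
open import Data.Fin using (Fin; zero; suc; toℕ; splitAt; _↑ˡ_)
open import Data.Product using (_×_; _,_; ∃-syntax)
open import Data.Sum using (inj₁; inj₂)
open import Data.Vec.Functional using (Vector; []; _∷_; head; tail; updateAt; _++_; concat)
open import Data.Vec.Functional.Properties using (lookup-++ˡ)
open import Function using (_∘_; const)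
open import Relation.Binary.Definitions using (Transitive)
open import Relation.Binary.PropositionalEquality as ≡ using (_≡_; _≗_)

module _ {a} {A : Set a} where

  ++-tail : ∀ {m n} (xs : Vector A (suc m)) (ys : Vector A n) → (xs ++ ys) ∘ suc ≗ tail xs ++ ys
  ++-tail {m} xs ys i with splitAt m i
  ... | inj₁ _ = ≡.refl
  ... | inj₂ _ = ≡.refl

  concat-suc : ∀ {m n} (xss : Vector (Vector A m) (suc n)) → concat xss ≗ head xss ++ concat (tail xss)
  concat-suc {m} xss i with splitAt m i
  ... | inj₁ _ = ≡.refl
  ... | inj₂ _ = ≡.refl

  updateAt-head : ∀ {n} (u w : A) (vs : Vector A n) → updateAt (u ∷ vs) zero (const w) ≗ w ∷ vs
  updateAt-head u w vs zero    = ≡.refl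
  updateAt-head u w vs (suc _) = ≡.refl

  updateAt-tail : ∀ {n} (u : A) (vs : Vector A n) j f → updateAt (u ∷ vs) (suc j) f ≗ u ∷ updateAt vs j f
  updateAt-tail u vs j f zero    = ≡.refl
  updateAt-tail u vs j f (suc _) = ≡.refl

module _ {c ℓ} (F : Field c ℓ) where
  open Field F hiding (zero)
  open import Algebra.Properties.Semiring.Sum semiring
    using (sum; sum-cong-≋; sum-replicate-zero; ∑-distrib-+; *-distribˡ-sum)
  open import Algebra.Properties.Monoid.Sum *-monoid
    using () renaming (sum to product; sum-cong-≋ to product-cong)
  open import Algebra.Properties.Ring ring using (-‿+-comm; -‿distribʳ-*)

  sum-≈0 : ∀ {m} (xs : Vector Carrier m) → (∀ i → xs i ≈ 0#) → sum xs ≈ 0#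
  sum-≈0 {m} xs xs≈0 = trans (sum-cong-≋ xs≈0) (sum-replicate-zero m)

  sum-map-++ : ∀ {b m n} {B : Set b} (h : B → Carrier) (xs : Vector B m) (ys : Vector B n) →
               sum (h ∘ (xs ++ ys)) ≈ sum (h ∘ xs) + sum (h ∘ ys)
  sum-map-++ {m = zero}  h xs ys = sym (+-identityˡ _)
  sum-map-++ {m = suc m} h xs ys = trans
    (+-congˡ (trans (sum-cong-≋ (λ i → reflexive (≡.cong h (++-tail xs ys i))))
                    (sum-map-++ h (tail xs) ys)))
    (sym (+-assoc _ _ _))

  sum-map-concat : ∀ {b m n} {B : Set b} (h : B → Carrier) (xss : Vector (Vector B m) n) →
                   sum (h ∘ concat xss) ≈ sum (λ k → sum (h ∘ xss k))
  sum-map-concat {n = zero}  h xss = refl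
  sum-map-concat {n = suc n} h xss = trans
    (sum-cong-≋ (λ i → reflexive (≡.cong h (concat-suc xss i))))
    (trans (sum-map-++ h (head xss) (concat (tail xss)))
           (+-congˡ (sum-map-concat h (tail xss))))

  sum-truncate : ∀ {m N} → m ≤ N → (H : ℕ → Carrier) → (∀ i → m ≤ i → H i ≈ 0#) →
                 sum {N} (H ∘ toℕ) ≈ sum {m} (H ∘ toℕ)
  sum-truncate {N = N} z≤n H vanish = sum-≈0 {N} (H ∘ toℕ) (λ i → vanish (toℕ i) z≤n)
  sum-truncate (s≤s m≤N) H vanish =
    +-congˡ (sum-truncate m≤N (H ∘ suc) (λ i m≤i → vanish (suc i) (s≤s m≤i)))

  ∘-embedding : ∀ {n a r b s a₂ r₂} {S : NSpace F n a r} {T : NSpace F n b s} {U : NSpace F n a₂ r₂} →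
                Transitive (NSpace._≈V_ U) → Embedding F T U → Embedding F S T → Embedding F S U
  ∘-embedding ≈U-trans e₂ e₁ = record
    { f         = E₂.f ∘ E₁.f
    ; cong      = E₂.cong ∘ E₁.cong
    ; additive  = λ u v → ≈U-trans (E₂.cong (E₁.additive u v)) (E₂.additive _ _)
    ; homog     = λ a u → ≈U-trans (E₂.cong (E₁.homog a u)) (E₂.homog a _)
    ; injective = E₁.injective ∘ E₂.injective
    ; pullback  = λ us → trans (E₂.pullback (E₁.f ∘ us)) (E₁.pullback us)
    }
    where
      module E₁ = Embedding e₁
      module E₂ = Embedding e₂

  record LinearForm (d : ℕ) : Set (c ⊔ ℓ) where
    field
      apply       : Kd F d → Carrier
      apply-cong  : ∀ {u v} → _≈d_ F u v → apply u ≈ apply v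
      additive    : ∀ u v → apply (λ i → u i + v i) ≈ apply u + apply v
      homogeneous : ∀ a u → apply (λ i → a * u i) ≈ a * apply u
  open LinearForm

  coordinate : ∀ {d} → Fin d → LinearForm d
  coordinate k = record
    { apply       = λ u → u k
    ; apply-cong  = λ u≈v → u≈v k
    ; additive    = λ _ _ → refl
    ; homogeneous = λ _ _ → refl
    }

  negate : ∀ {d} → LinearForm d → LinearForm d
  negate l = record
    { apply       = λ u → - apply l u
    ; apply-cong  = -‿cong ∘ apply-cong l
    ; additive    = λ u v → trans (-‿cong (additive l u v)) (sym (-‿+-comm _ _))
    ; homogeneous = λ a u → trans (-‿cong (homogeneous l a u)) (-‿distribʳ-* a _)
    }

  basis : ∀ {d} → Fin d → Kd F d
  basis zero    zero    = 1#
  basis zero    (suc _) = 0#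
  basis (suc _) zero    = 0#
  basis (suc k) (suc i) = basis k i

  combination : ∀ {m d} → Vector Carrier m → Vector (Kd F d) m → Kd F d
  combination a w i = sum (λ k → a k * w k i)

  ≈-combination-basis : ∀ {d} (u : Kd F d) → _≈d_ F u (combination u basis)
  ≈-combination-basis u zero = sym (trans
    (+-cong (*-identityʳ _) (sum-≈0 (λ k → u (suc k) * 0#) (λ _ → zeroʳ _)))
    (+-identityʳ _))
  ≈-combination-basis u (suc i) = trans
    (≈-combination-basis (tail u) i)
    (sym (trans (+-congʳ (zeroʳ _)) (+-identityˡ _)))

  apply-combination : ∀ {m d} (l : LinearForm d) (a : Vector Carrier m) (w : Vector (Kd F d) m) →
                      apply l (combination a w) ≈ sum (λ k → a k * apply l (w k))
  apply-combination {zero}  l a w = trans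
    (apply-cong l (λ _ → sym (zeroˡ 0#)))
    (trans (homogeneous l 0# (λ _ → 0#)) (zeroˡ _))
  apply-combination {suc m} l a w = trans
    (additive l _ (combination (tail a) (tail w)))
    (+-cong (homogeneous l (a zero) (w zero)) (apply-combination l (tail a) (tail w)))

  apply-expansion : ∀ {d} (l : LinearForm d) u → apply l u ≈ sum (λ k → u k * apply l (basis k))
  apply-expansion l u = trans (apply-cong l (≈-combination-basis u)) (apply-combination l u basis)

  module _ {n d} {φ : Vector (Kd F d) (suc n) → Carrier} (M : Multilinear F (suc n) d φ) where
    open Multilinear M

    φ-≗ : ∀ {us vs} → us ≗ vs → φ us ≈ φ vs
    φ-≗ us≗vs = φ-cong (λ j i → reflexive (≡.cong (λ w → w i) (us≗vs j)))

    headForm : Vector (Kd F d) n → LinearForm d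
    headForm vs = record
      { apply       = λ u → φ (u ∷ vs)
      ; apply-cong  = λ u≈v → φ-cong (λ { zero → u≈v ; (suc _) → λ _ → refl })
      ; additive    = λ u v → trans
          (sym (φ-≗ (updateAt-head u _ vs)))
          (trans (φ-add (u ∷ vs) zero u v)
                 (+-cong (φ-≗ (updateAt-head u u vs)) (φ-≗ (updateAt-head u v vs))))
      ; homogeneous = λ a u → trans
          (sym (φ-≗ (updateAt-head u _ vs)))
          (trans (φ-scale (u ∷ vs) zero a u) (*-congˡ (φ-≗ (updateAt-head u u vs))))
      }

    tailMultilinear : (u : Kd F d) → Multilinear F n d (λ vs → φ (u ∷ vs))
    tailMultilinear u = record
      { φ-cong  = λ us≈vs → φ-cong (λ { zero → λ _ → refl ; (suc j) → us≈vs j })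
      ; φ-add   = λ us j v w → trans
          (sym (φ-≗ (updateAt-tail u us j _)))
          (trans (φ-add (u ∷ us) (suc j) v w)
                 (+-cong (φ-≗ (updateAt-tail u us j _)) (φ-≗ (updateAt-tail u us j _))))
      ; φ-scale = λ us j a v → trans
          (sym (φ-≗ (updateAt-tail u us j _)))
          (trans (φ-scale (u ∷ us) (suc j) a v) (*-congˡ (φ-≗ (updateAt-tail u us j _))))
      }

    head-expansion : ∀ u vs → φ (u ∷ vs) ≈ sum (λ k → u k * φ (basis k ∷ vs))
    head-expansion u vs = apply-expansion (headForm vs) u

  tensor : ∀ {n d} → (Fin n → LinearForm d) → Vector (Kd F d) n → Carrier
  tensor ls us = product (λ j → apply (ls j) (us j))

  record Decomposition (m n d : ℕ) (φ : Vector (Kd F d) n → Carrier) : Set (c ⊔ ℓ) where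
    field
      factor          : Fin m → Fin n → LinearForm d
      sum-of-tensors  : ∀ us → sum (λ i → tensor (factor i) us) ≈ φ us
  open Decomposition

  decompose : ∀ {n d φ} → Multilinear F (suc n) d φ → Decomposition (d ^ n) (suc n) d φ
  decompose {zero} M = record
    { factor         = λ _ _ → headForm M []
    ; sum-of-tensors = λ us → trans (+-identityʳ _)
                                    (trans (*-identityʳ _) (φ-≗ M (λ { zero → ≡.refl })))
    }
  decompose {suc n} {d} {φ} M = record
    { factor         = concat rows
    ; sum-of-tensors = λ us → trans (sum-map-concat (λ ls → tensor ls us) rows) (expand us)
    }
    where
      D : (k : Fin d) → Decomposition (d ^ n) (suc n) d (λ vs → φ (basis k ∷ vs))
      D k = decompose (tailMultilinear M (basis k))

      rows : Fin d → Fin (d ^ n) → Fin (suc (suc n)) → LinearForm d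
      rows k r = coordinate k ∷ factor (D k) r

      expand : ∀ us → sum (λ k → sum (λ r → tensor (rows k r) us)) ≈ φ us
      expand us = trans
        (sum-cong-≋ (λ k → trans
          (sym (*-distribˡ-sum (us zero k) (λ r → tensor (factor (D k) r) (tail us))))
          (*-congˡ (sum-of-tensors (D k) (tail us)))))
        (trans (sym (head-expansion M (us zero) (tail us)))
               (φ-≗ M (λ { zero → ≡.refl ; (suc _) → ≡.refl })))

  Separating : ∀ {m n d} → (Fin m → Fin n → LinearForm d) → Set (c ⊔ ℓ)
  Separating {d = d} L = ∀ {u v : Kd F d} → (∀ i j → apply (L i j) u ≈ apply (L i j) v) → _≈d_ F u v

  diagonal antidiagonal : ∀ {n d} → Fin d → Fin (suc n) → LinearForm d
  diagonal     k = const (coordinate k)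
  antidiagonal k = negate (coordinate k) ∷ const (coordinate k)

  diagonal+antidiagonal≈0 : ∀ {n d} (k : Fin d) us →
                            tensor (diagonal {n} k) us + tensor (antidiagonal k) us ≈ 0#
  diagonal+antidiagonal≈0 k us = trans
    (sym (distribʳ _ (us zero k) (- us zero k)))
    (trans (*-congʳ (-‿inverseʳ _)) (zeroˡ _))

  separate : ∀ {m n d φ} → Decomposition m (suc n) d φ → Decomposition ((d ℕ.+ d) ℕ.+ m) (suc n) d φ
  separate {n = n} {d} D = record
    { factor         = (diagonal ++ antidiagonal) ++ factor D
    ; sum-of-tensors = λ us → trans
        (sum-map-++ (λ ls → tensor ls us) (diagonal ++ antidiagonal) (factor D))
        (trans (+-congʳ (pairs≈0 us)) (trans (+-identityˡ _) (sum-of-tensors D us)))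
    }
    where
      pairs≈0 : ∀ us → sum (λ i → tensor ((diagonal {n} {d} ++ antidiagonal) i) us) ≈ 0#
      pairs≈0 us = trans
        (sum-map-++ (λ ls → tensor ls us) diagonal antidiagonal)
        (trans (sym (∑-distrib-+ (λ k → tensor (diagonal k) us) (λ k → tensor (antidiagonal k) us)))
               (sum-≈0 _ (λ k → diagonal+antidiagonal≈0 k us)))

  separate-separating : ∀ {m n d φ} (D : Decomposition m (suc n) d φ) → Separating (factor (separate D))
  separate-separating {m} {d = d} D {u} {v} agree k =
    ≡.subst (λ ls → apply (ls zero) u ≈ apply (ls zero) v) coordinate-row (agree _ zero)
    where
      coordinate-row : factor (separate D) ((k ↑ˡ d) ↑ˡ m) ≡ diagonal k
      coordinate-row = ≡.trans (lookup-++ˡ (diagonal ++ antidiagonal) (factor D) (k ↑ˡ d))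
                               (lookup-++ˡ diagonal antidiagonal k)

  decomposition-embedding : ∀ {m n d φ} (D : Decomposition m n d φ) → Separating (factor D) →
                            Embedding F (KdSpace F n d φ) (Vm F n m)
  decomposition-embedding D separating = record
    { f         = λ u i j → apply (factor D i j) u
    ; cong      = λ u≈v i j → apply-cong (factor D i j) u≈v
    ; additive  = λ u v i j → additive (factor D i j) u v
    ; homog     = λ a u i j → homogeneous (factor D i j) a u
    ; injective = separating
    ; pullback  = sum-of-tensors D
    }

  extendByZero : ∀ {m} → Vector Carrier m → ℕ → Carrier
  extendByZero {zero}  w i       = 0#
  extendByZero {suc m} w zero    = w zero
  extendByZero {suc m} w (suc i) = extendByZero (tail w) i

  extendByZero-≥ : ∀ {m} (w : Vector Carrier m) i → m ≤ i → extendByZero w i ≈ 0#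
  extendByZero-≥ {zero}  w i       m≤i       = refl
  extendByZero-≥ {suc m} w (suc i) (s≤s m≤i) = extendByZero-≥ (tail w) i m≤i

  extendByZero-toℕ : ∀ {m} (w : Vector Carrier m) r → extendByZero w (toℕ r) ≈ w r
  extendByZero-toℕ w zero    = refl
  extendByZero-toℕ w (suc r) = extendByZero-toℕ (tail w) r

  extendByZero-cong : ∀ {m} {w w₂ : Vector Carrier m} → (∀ r → w r ≈ w₂ r) →
                      ∀ i → extendByZero w i ≈ extendByZero w₂ i
  extendByZero-cong {zero}  w≈w₂ i       = refl
  extendByZero-cong {suc m} w≈w₂ zero    = w≈w₂ zero
  extendByZero-cong {suc m} w≈w₂ (suc i) = extendByZero-cong (w≈w₂ ∘ suc) i

  extendByZero-+ : ∀ {m} (w w₂ : Vector Carrier m) i →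
                   extendByZero (λ r → w r + w₂ r) i ≈ extendByZero w i + extendByZero w₂ i
  extendByZero-+ {zero}  w w₂ i       = sym (+-identityˡ 0#)
  extendByZero-+ {suc m} w w₂ zero    = refl
  extendByZero-+ {suc m} w w₂ (suc i) = extendByZero-+ (tail w) (tail w₂) i

  extendByZero-* : ∀ {m} a (w : Vector Carrier m) i →
                   extendByZero (λ r → a * w r) i ≈ a * extendByZero w i
  extendByZero-* {zero}  a w i       = sym (zeroʳ a)
  extendByZero-* {suc m} a w zero    = refl
  extendByZero-* {suc m} a w (suc i) = extendByZero-* a (tail w) i

  -- Positive arity is needed: for arity 0, ω is identically 0 on V but not on V_m.
  Vm↪V : ∀ {n m} → Embedding F (Vm F (suc n) m) (Vspace F (suc n))
  Vm↪V {n} {m} = record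
    { f         = include
    ; cong      = λ w≈w₂ i j → extendByZero-cong (λ r → w≈w₂ r j) i
    ; additive  = λ w w₂ i j → extendByZero-+ (column w j) (column w₂ j) i
    ; homog     = λ a w i j → extendByZero-* a (column w j) i
    ; injective = λ {w} {w₂} agree r j → trans (sym (extendByZero-toℕ (column w j) r))
                                              (trans (agree (toℕ r) j) (extendByZero-toℕ (column w₂ j) r))
    ; pullback  = λ ws → trans
        (sum-truncate (m≤m⊔n m _) (λ i → product (λ j → extendByZero (column (ws j) j) i)) (λ i m≤i →
          trans (*-congʳ (extendByZero-≥ (column (ws zero) zero) i m≤i)) (zeroˡ _)))
        (sum-cong-≋ (λ r → product-cong (λ j → extendByZero-toℕ (column (ws j) j) r)))
    }
    where
      column : (Fin m → Fin (suc n) → Carrier) → Fin (suc n) → Vector Carrier m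
      column w j r = w r j

      include : (Fin m → Fin (suc n) → Carrier) → Vinf F (suc n)
      include w = record
        { coeff   = λ i j → extendByZero (column w j) i
        ; bound   = m
        ; support = λ i m≤i j → extendByZero-≥ (column w j) i m≤i
        }

lemma3p3 : ∀ {c ℓ : Level} (F : Field c ℓ) → CharZero F →
    (n : ℕ) → 1 ≤ n →
    Universal F (Vspace F n)
    × (∀ (d : ℕ) → ∃[ m ] DUniversal F d (Vm F n m))
lemma3p3 F _ (suc n) _ = universal , λ d → (d ℕ.+ d) ℕ.+ d ^ n , embed d
  where
    open Field F using (trans)

    embed : ∀ d → DUniversal F d (Vm F (suc n) ((d ℕ.+ d) ℕ.+ d ^ n))
    embed d φ M = decomposition-embedding F (separate F D) (separate-separating F D)
      where D = decompose F M

    universal : Universal F (Vspace F (suc n))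
    universal d φ M = ∘-embedding F (λ p q i j → trans (p i j) (q i j)) (Vm↪V F) (embed d φ M)
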